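{- Let $r\ge 1$ and let $G$ be a connected $r$-regular graph. Then $G$ has a strong clique of size two if and only if $G\cong K_{r,r}$.
   Context: All graphs are finite, simple and undirected. A clique in a graph $G$ is strong if it intersects every maximal independent set of $G$. $K_{r,r}$ is the complete bipartite graph with both parts of size $r$. -}

module Defs where

open import Data.Nat using (ℕ; _+_; _<?_)
open import Data.Fin using (Fin; toℕ)
open import Data.Fin.Subset using (Subset; _∈_; _∉_; _⊆_; ∣_∣)
open import Data.Bool using (Bool)
open import Data.Bool.Properties using () renaming (_≟_ to _≟B_)
open import Data.List using (List; []; _∷_; length; filter)
open import Data.List using () renaming (allFin to allFinL)
open import Data.Product using (Σ; ∃; ∃-syntax; _×_; _,_)
open import Data.Sum using (_⊎_)
open import Relation.Nullary using (¬_; Dec; yes; no)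
open import Relation.Nullary.Decidable using (isYes; ¬?)
open import Relation.Binary.PropositionalEquality using (_≡_; _≢_; refl; sym)
open import Function.Bundles using (_↔_; Inverse)
open import Level using (0ℓ)

record Graph : Set₁ where
  field
    n     : ℕ
    Adj   : Fin n → Fin n → Set
    adj?  : ∀ u v → Dec (Adj u v)
    irrefl : ∀ v → ¬ Adj v v
    sym-adj : ∀ {u v} → Adj u v → Adj v u

open Graph public

degree : (G : Graph) → Fin (n G) → ℕ
degree G v = length (filter (adj? G v) (allFinL (n G)))

Regular : ℕ → Graph → Set
Regular r G = ∀ v → degree G v ≡ r

data Walk (G : Graph) : Fin (n G) → Fin (n G) → Set where
  [] : ∀ {v} → Walk G v v
  _∷_ : ∀ {u v w} → Adj G u v → Walk G v w → Walk G u w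

Connected : Graph → Set
Connected G = ∀ u v → Walk G u v

Independent : (G : Graph) → Subset (n G) → Set
Independent G S = ∀ u v → u ∈ S → v ∈ S → ¬ Adj G u v

MaximalIndependent : (G : Graph) → Subset (n G) → Set
MaximalIndependent G S =
  Independent G S × (∀ T → Independent G T → S ⊆ T → T ⊆ S)

IsClique : (G : Graph) → Subset (n G) → Set
IsClique G C = ∀ u v → u ∈ C → v ∈ C → u ≢ v → Adj G u v

IsStrongClique : (G : Graph) → Subset (n G) → Set
IsStrongClique G C =
  IsClique G C × (∀ S → MaximalIndependent G S → ∃[ v ] (v ∈ C × v ∈ S))

_≅_ : Graph → Graph → Set
G ≅ H = Σ (Fin (n G) ↔ Fin (n H)) λ f →
  ∀ u v → (Adj G u v → Adj H (Inverse.to f u) (Inverse.to f v))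
        × (Adj H (Inverse.to f u) (Inverse.to f v) → Adj G u v)

side : (r : ℕ) → Fin (r + r) → Bool
side r i = isYes (toℕ i <? r)

K : ℕ → Graph
K r = record
  { n = r + r
  ; Adj = λ i j → side r i ≢ side r j
  ; adj? = λ i j → ¬? (side r i ≟B side r j)
  ; irrefl = λ v ne → ne refl
  ; sym-adj = λ ne eq → ne (sym eq)
  }

-- If {u, v} is a strong clique and x ~ u, y ~ v, then x ~ y: otherwise a maximal independent
-- set containing x and y would avoid both u and v.  So N(v) ⊆ N(x) for every x ∈ N(u), and
-- regularity turns this into N(x) = N(v); symmetrically N(y) = N(u) for y ∈ N(v).  Hence
-- crossing an edge swaps the disjoint sets N(u) and N(v), by connectedness they cover G, and G
-- is the complete bipartite graph between them, each side of size r.  Conversely, if G is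
-- complete bipartite and a maximal independent set S misses both ends of an edge pq, it contains
-- a neighbour of p and a neighbour of q; these lie on opposite sides, so they are adjacent.
module Submission where

open import Defs
open import Data.Nat using (ℕ; suc; _+_; _<_; _≤_; _≥_; _<?_)
open import Data.Nat.Properties using (m≤m+n; <⇒≱; suc-injective)
open import Data.Bool using (Bool; true; false)
open import Data.Bool.Properties using (¬-not)
open import Data.Fin using (Fin; zero; suc; toℕ; _↑ˡ_; _↑ʳ_; join; _≟_)
open import Data.Fin.Properties using (any?; toℕ-↑ˡ; toℕ-↑ʳ; toℕ<n; +↔⊎)
open import Data.Fin.Subset using (Subset; _∈_; _⊆_; ∣_∣; ⁅_⁆; _∪_; ⊥; inside; outside)
open import Data.Fin.Subset.Properties
  using (_∈?_; x∈⁅x⁆; x∈⁅y⁆⇒x≡y; x∈p∪q⁻; x∈p∪q⁺; p⊆p∪q; ∣⁅x⁆∣≡1; ∪-identityˡ; ∪-identityʳ)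
open import Data.Vec using ([]; _∷_)
open import Data.List using (List; []; _∷_; length; filter; lookup; foldl; allFin)
open import Data.List.Properties using (filter-≐)
open import Data.List.Membership.Propositional using () renaming (_∈_ to _∈ₗ_)
open import Data.List.Membership.Propositional.Properties
  using (∈-filter⁺; ∈-filter⁻; ∈-lookup; ∈-allFin)
open import Data.List.Membership.Setoid.Properties using (unique⇒irrelevant)
open import Data.List.Relation.Unary.Any using (here; there; index)
open import Data.List.Relation.Unary.Any.Properties using (lookup-index)
open import Data.List.Relation.Unary.Unique.Propositional using (Unique)
open import Data.List.Relation.Unary.Unique.Propositional.Properties using (filter⁺; allFin⁺)
open import Data.List.Relation.Binary.Pointwise using (Pointwise-≡⇒≡)
open import Data.List.Relation.Binary.Sublist.Propositional using (⊆-refl)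
open import Data.List.Relation.Binary.Sublist.Propositional.Properties
  using (to-≋) renaming (filter⁺ to filter⁺-⊆)
open import Data.Product using (∃-syntax; _×_; _,_; proj₁; proj₂; Σ-syntax)
open import Data.Sum using (_⊎_; inj₁; inj₂; [_,_]′; swap; map; map₂)
open import Function using (_∘_; const)
open import Function.Bundles using (_⇔_; mk⇔; Equivalence; _↔_; Inverse; mk↔ₛ′)
open import Function.Properties.Inverse using (↔-sym; ↔-trans)
open import Level using (0ℓ)
open import Relation.Nullary using (¬_; Dec; does; yes; no; contradiction; _×-dec_)
open import Relation.Nullary.Decidable using (isYes≗does; dec-true; dec-false)
open import Relation.Unary using (Pred; Decidable)
open import Relation.Unary.Properties using (∁?)
open import Relation.Binary.Definitions using (DecidableEquality)
open import Relation.Binary.PropositionalEquality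
  using (_≡_; _≢_; refl; sym; trans; cong; subst; subst₂; setoid)
open import Axiom.UniquenessOfIdentityProofs using (module Decidable⇒UIP)

filter-length-≡⇒⊇ : ∀ {A : Set} {P Q : Pred A 0ℓ} (P? : Decidable P) (Q? : Decidable Q) →
  (∀ {x} → P x → Q x) → ∀ xs → length (filter P? xs) ≡ length (filter Q? xs) →
  ∀ {x} → x ∈ₗ xs → Q x → P x
filter-length-≡⇒⊇ P? Q? P⊆Q xs same-length x∈xs qx = proj₂ (∈-filter⁻ P? {xs = xs} x∈filter-P)
  where
  filter-P≡filter-Q : filter P? xs ≡ filter Q? xs
  filter-P≡filter-Q =
    Pointwise-≡⇒≡ (to-≋ same-length (filter⁺-⊆ P? Q? (λ { refl → P⊆Q }) (⊆-refl {x = xs})))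
  x∈filter-P : _ ∈ₗ filter P? xs
  x∈filter-P = subst (_ ∈ₗ_) (sym filter-P≡filter-Q) (∈-filter⁺ Q? x∈xs qx)

index-∈-lookup : ∀ {A : Set} (xs : List A) i → index (∈-lookup {xs = xs} i) ≡ i
index-∈-lookup (x ∷ xs) zero    = refl
index-∈-lookup (x ∷ xs) (suc i) = cong suc (index-∈-lookup xs i)

unique⇒index-lookup : ∀ {A : Set} → DecidableEquality A → ∀ {xs : List A} → Unique xs →
  ∀ i (x∈xs : lookup xs i ∈ₗ xs) → index x∈xs ≡ i
unique⇒index-lookup {A} _≟A_ {xs} unique i x∈xs = trans
  (cong index (unique⇒irrelevant (setoid A) (Decidable⇒UIP.≡-irrelevant _≟A_) unique
                                 x∈xs (∈-lookup i)))
  (index-∈-lookup xs i)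

module Members {N : ℕ} {P : Pred (Fin N) 0ℓ} (P? : Decidable P) where

  members : List (Fin N)
  members = filter P? (allFin N)

  member : Fin (length members) → Fin N
  member = lookup members

  position : ∀ {w} → P w → Fin (length members)
  position {w} pw = index (∈-filter⁺ P? (∈-allFin w) pw)

  member-satisfies : ∀ i → P (member i)
  member-satisfies i = proj₂ (∈-filter⁻ P? {xs = allFin N} (∈-lookup i))

  member-position : ∀ {w} (pw : P w) → member (position pw) ≡ w
  member-position {w} pw = sym (lookup-index (∈-filter⁺ P? (∈-allFin w) pw))

  position-member : ∀ i (pw : P (member i)) → position pw ≡ i
  position-member i pw = unique⇒index-lookup _≟_ (filter⁺ P? (allFin⁺ N)) i _

open Members using (members; member; position; member-satisfies; member-position; position-member)

left? : {A B : Set} → A ⊎ B → Bool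
left? = [ const true , const false ]′

partition-↔ : ∀ {N} {P : Pred (Fin N) 0ℓ} (P? : Decidable P) {a b : ℕ} →
  length (members P?) ≡ a → length (members (∁? P?)) ≡ b →
  Σ[ φ ∈ Fin N ↔ (Fin a ⊎ Fin b) ] ∀ w → left? (Inverse.to φ w) ≡ does (P? w)
partition-↔ {N} {P} P? refl refl = mk↔ₛ′ to from to∘from from∘to , left?∘to
  where
  classify : ∀ {w} → Dec (P w) → Fin _ ⊎ Fin _
  classify (yes p) = inj₁ (position P? p)
  classify (no ¬p) = inj₂ (position (∁? P?) ¬p)

  to : Fin N → Fin _ ⊎ Fin _
  to w = classify (P? w)

  from : Fin _ ⊎ Fin _ → Fin N
  from = [ member P? , member (∁? P?) ]′

  from∘to : ∀ w → from (to w) ≡ w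
  from∘to w with P? w
  ... | yes p = member-position P? p
  ... | no ¬p = member-position (∁? P?) ¬p

  to∘from : ∀ x → to (from x) ≡ x
  to∘from (inj₁ i) with P? (member P? i)
  ... | yes p = cong inj₁ (position-member P? i p)
  ... | no ¬p = contradiction (member-satisfies P? i) ¬p
  to∘from (inj₂ i) with P? (member (∁? P?) i)
  ... | yes p = contradiction p (member-satisfies (∁? P?) i)
  ... | no ¬p = cong inj₂ (position-member (∁? P?) i ¬p)

  left?∘to : ∀ w → left? (to w) ≡ does (P? w)
  left?∘to w with P? w
  ... | yes _ = refl
  ... | no _ = refl

pair : ∀ {N} → Fin N → Fin N → Subset N
pair x y = ⁅ x ⁆ ∪ ⁅ y ⁆

module _ {N : ℕ} {x y : Fin N} where

  ∈-pairˡ : x ∈ pair x y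
  ∈-pairˡ = x∈p∪q⁺ (inj₁ (x∈⁅x⁆ x))

  ∈-pairʳ : y ∈ pair x y
  ∈-pairʳ = x∈p∪q⁺ (inj₂ (x∈⁅x⁆ y))

  ∈-pair⁻ : ∀ {w} → w ∈ pair x y → w ≡ x ⊎ w ≡ y
  ∈-pair⁻ {w} w∈xy = map (x∈⁅y⁆⇒x≡y x) (x∈⁅y⁆⇒x≡y y) (x∈p∪q⁻ ⁅ x ⁆ ⁅ y ⁆ w∈xy)

∣pair∣≡2 : ∀ {N} (x y : Fin N) → x ≢ y → ∣ pair x y ∣ ≡ 2
∣pair∣≡2 zero    zero    x≢y = contradiction refl x≢y
∣pair∣≡2 zero    (suc y) _   = cong suc (trans (cong ∣_∣ (∪-identityˡ ⁅ y ⁆)) (∣⁅x⁆∣≡1 y))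
∣pair∣≡2 (suc x) zero    _   = cong suc (trans (cong ∣_∣ (∪-identityʳ ⁅ x ⁆)) (∣⁅x⁆∣≡1 x))
∣pair∣≡2 (suc x) (suc y) x≢y = ∣pair∣≡2 x y (x≢y ∘ cong suc)

∣p∣≡0⇒p≡⊥ : ∀ {N} (p : Subset N) → ∣ p ∣ ≡ 0 → p ≡ ⊥
∣p∣≡0⇒p≡⊥ []            _ = refl
∣p∣≡0⇒p≡⊥ (outside ∷ p) e = cong (outside ∷_) (∣p∣≡0⇒p≡⊥ p e)

∣p∣≡1⇒p≡⁅x⁆ : ∀ {N} (p : Subset N) → ∣ p ∣ ≡ 1 → ∃[ x ] p ≡ ⁅ x ⁆
∣p∣≡1⇒p≡⁅x⁆ (inside ∷ p)  e = zero , cong (inside ∷_) (∣p∣≡0⇒p≡⊥ p (suc-injective e))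
∣p∣≡1⇒p≡⁅x⁆ (outside ∷ p) e with x , p≡⁅x⁆ ← ∣p∣≡1⇒p≡⁅x⁆ p e = suc x , cong (outside ∷_) p≡⁅x⁆

∣p∣≡2⇒p≡pair : ∀ {N} (p : Subset N) → ∣ p ∣ ≡ 2 → ∃[ x ] ∃[ y ] (x ≢ y × p ≡ pair x y)
∣p∣≡2⇒p≡pair (inside ∷ p) e with y , p≡⁅y⁆ ← ∣p∣≡1⇒p≡⁅x⁆ p (suc-injective e) =
  zero , suc y , (λ ()) , cong (inside ∷_) (trans p≡⁅y⁆ (sym (∪-identityˡ ⁅ y ⁆)))
∣p∣≡2⇒p≡pair (outside ∷ p) e with x , y , x≢y , p≡xy ← ∣p∣≡2⇒p≡pair p e =
  suc x , suc y , (λ { refl → x≢y refl }) , cong (outside ∷_) p≡xy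

module _ (G : Graph) where

  pair-clique : ∀ {x y} → Adj G x y → IsClique G (pair x y)
  pair-clique xy a b a∈ b∈ a≢b with ∈-pair⁻ a∈ | ∈-pair⁻ b∈
  ... | inj₁ refl | inj₁ refl = contradiction refl a≢b
  ... | inj₁ refl | inj₂ refl = xy
  ... | inj₂ refl | inj₁ refl = sym-adj G xy
  ... | inj₂ refl | inj₂ refl = contradiction refl a≢b

  pair-independent : ∀ {x y} → ¬ Adj G x y → Independent G (pair x y)
  pair-independent ¬xy a b a∈ b∈ ab with ∈-pair⁻ a∈ | ∈-pair⁻ b∈
  ... | inj₁ refl | inj₁ refl = irrefl G a ab
  ... | inj₁ refl | inj₂ refl = ¬xy ab
  ... | inj₂ refl | inj₁ refl = ¬xy (sym-adj G ab)
  ... | inj₂ refl | inj₂ refl = irrefl G a ab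

  CanJoin : Subset (n G) → Fin (n G) → Set
  CanJoin S x = ∀ z → z ∈ S → ¬ Adj G x z

  HasNeighbourIn : Subset (n G) → Fin (n G) → Set
  HasNeighbourIn S x = ∃[ z ] (z ∈ S × Adj G x z)

  Dominates : Subset (n G) → Fin (n G) → Set
  Dominates S x = x ∈ S ⊎ HasNeighbourIn S x

  canJoin⊎hasNeighbourIn : ∀ S x → CanJoin S x ⊎ HasNeighbourIn S x
  canJoin⊎hasNeighbourIn S x with any? (λ z → (z ∈? S) ×-dec adj? G x z)
  ... | yes neighbour = inj₂ neighbour
  ... | no ¬neighbour = inj₁ λ z z∈S xz → ¬neighbour (z , z∈S , xz)

  ∪⁅⁆-independent : ∀ {S x} → Independent G S → CanJoin S x → Independent G (S ∪ ⁅ x ⁆)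
  ∪⁅⁆-independent {S} {x} S-ind x-free a b a∈ b∈ ab with ∈-∪⁅⁆⁻ a∈ | ∈-∪⁅⁆⁻ b∈
    where
    ∈-∪⁅⁆⁻ : ∀ {w} → w ∈ S ∪ ⁅ x ⁆ → w ∈ S ⊎ w ≡ x
    ∈-∪⁅⁆⁻ w∈ = map₂ (x∈⁅y⁆⇒x≡y x) (x∈p∪q⁻ S ⁅ x ⁆ w∈)
  ... | inj₁ a∈S  | inj₁ b∈S  = S-ind a b a∈S b∈S ab
  ... | inj₁ a∈S  | inj₂ refl = x-free a a∈S (sym-adj G ab)
  ... | inj₂ refl | inj₁ b∈S  = x-free b b∈S ab
  ... | inj₂ refl | inj₂ refl = irrefl G a ab

  maximal⇒dominating : ∀ {S} → MaximalIndependent G S → ∀ x → Dominates S x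
  maximal⇒dominating {S} (S-ind , S-max) x with canJoin⊎hasNeighbourIn S x
  ... | inj₁ x-free = inj₁ (S-max (S ∪ ⁅ x ⁆) (∪⁅⁆-independent S-ind x-free) (p⊆p∪q ⁅ x ⁆)
                                  (x∈p∪q⁺ (inj₂ (x∈⁅x⁆ x))))
  ... | inj₂ neighbour = inj₂ neighbour

  dominating⇒maximal : ∀ {S} → Independent G S → (∀ x → Dominates S x) → MaximalIndependent G S
  dominating⇒maximal {S} S-ind S-dom = S-ind , absorbed
    where
    absorbed : ∀ T → Independent G T → S ⊆ T → T ⊆ S
    absorbed T T-ind S⊆T {x} x∈T with S-dom x
    ... | inj₁ x∈S = x∈S
    ... | inj₂ (z , z∈S , xz) = contradiction xz (T-ind x z x∈T (S⊆T z∈S))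

  dominates-mono : ∀ {S T x} → S ⊆ T → Dominates S x → Dominates T x
  dominates-mono S⊆T (inj₁ x∈S)            = inj₁ (S⊆T x∈S)
  dominates-mono S⊆T (inj₂ (z , z∈S , xz)) = inj₂ (z , S⊆T z∈S , xz)

  insert : Subset (n G) → Fin (n G) → Subset (n G)
  insert S x with canJoin⊎hasNeighbourIn S x
  ... | inj₁ _ = S ∪ ⁅ x ⁆
  ... | inj₂ _ = S

  insert-⊇ : ∀ S x → S ⊆ insert S x
  insert-⊇ S x with canJoin⊎hasNeighbourIn S x
  ... | inj₁ _ = p⊆p∪q ⁅ x ⁆
  ... | inj₂ _ = λ w∈S → w∈S

  insert-independent : ∀ {S} → Independent G S → ∀ x → Independent G (insert S x)
  insert-independent {S} S-ind x with canJoin⊎hasNeighbourIn S x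
  ... | inj₁ x-free = ∪⁅⁆-independent S-ind x-free
  ... | inj₂ _      = S-ind

  insert-dominates : ∀ S x → Dominates (insert S x) x
  insert-dominates S x with canJoin⊎hasNeighbourIn S x
  ... | inj₁ _         = inj₁ (x∈p∪q⁺ (inj₂ (x∈⁅x⁆ x)))
  ... | inj₂ neighbour = inj₂ neighbour

  foldl-insert-⊇ : ∀ S xs → S ⊆ foldl insert S xs
  foldl-insert-⊇ S []       w∈S = w∈S
  foldl-insert-⊇ S (x ∷ xs) w∈S = foldl-insert-⊇ (insert S x) xs (insert-⊇ S x w∈S)

  foldl-insert-independent : ∀ {S} → Independent G S → ∀ xs → Independent G (foldl insert S xs)
  foldl-insert-independent S-ind []       = S-ind
  foldl-insert-independent S-ind (x ∷ xs) = foldl-insert-independent (insert-independent S-ind x) xs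

  foldl-insert-dominates : ∀ S {x} xs → x ∈ₗ xs → Dominates (foldl insert S xs) x
  foldl-insert-dominates S (x ∷ xs) (here refl) =
    dominates-mono (foldl-insert-⊇ (insert S x) xs) (insert-dominates S x)
  foldl-insert-dominates S (y ∷ xs) (there x∈xs) = foldl-insert-dominates (insert S y) xs x∈xs

  extend-to-maximal : ∀ {S} → Independent G S → ∃[ R ] (MaximalIndependent G R × S ⊆ R)
  extend-to-maximal {S} S-ind =
    foldl insert S vertices ,
    dominating⇒maximal (foldl-insert-independent S-ind vertices)
                       (λ x → foldl-insert-dominates S vertices (∈-allFin x)) ,
    foldl-insert-⊇ S vertices
    where
    vertices : List (Fin (n G))
    vertices = allFin (n G)

connected⇒everywhere : ∀ {G : Graph} {P : Pred (Fin (n G)) 0ℓ} → Connected G →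
  (∀ {a b} → Adj G a b → P a → P b) → ∀ {x} → P x → ∀ w → P w
connected⇒everywhere {G} {P} connected step {x} Px w = along (connected x w) Px
  where
  along : ∀ {a b} → Walk G a b → P a → P b
  along []         Pa = Pa
  along (ab ∷ walk) Pa = along walk (step ab Pa)

regular-neighbourhood-⊆⇒⊇ : ∀ {r G} → Regular r G → ∀ {a b} →
  (∀ {z} → Adj G a z → Adj G b z) → ∀ {z} → Adj G b z → Adj G a z
regular-neighbourhood-⊆⇒⊇ {G = G} regular {a} {b} N[a]⊆N[b] {z} =
  filter-length-≡⇒⊇ (adj? G a) (adj? G b) N[a]⊆N[b] (allFin (n G))
    (trans (regular a) (sym (regular b))) (∈-allFin z)

CompleteBipartition : (G : Graph) → (Fin (n G) → Bool) → Set
CompleteBipartition G s = ∀ a b → Adj G a b ⇔ (s a ≢ s b)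

module _ {G : Graph} {s : Fin (n G) → Bool} (bipartition : CompleteBipartition G s) where

  completeBipartition-edge-strong : ∀ {p q} → s p ≢ s q → IsStrongClique G (pair p q)
  completeBipartition-edge-strong {p} {q} sp≢sq =
    pair-clique G (Equivalence.from (bipartition p q) sp≢sq) , meets
    where
    meets : ∀ S → MaximalIndependent G S → ∃[ w ] (w ∈ pair p q × w ∈ S)
    meets S S-max with maximal⇒dominating G S-max p | maximal⇒dominating G S-max q
    ... | inj₁ p∈S | _        = p , ∈-pairˡ , p∈S
    ... | _        | inj₁ q∈S = q , ∈-pairʳ , q∈S
    ... | inj₂ (z , z∈S , pz) | inj₂ (w , w∈S , qw) =
      contradiction (Equivalence.from (bipartition z w) sz≢sw) (proj₁ S-max z w z∈S w∈S)
      where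
      sz≡sq : s z ≡ s q
      sz≡sq = trans (¬-not (Equivalence.to (bipartition p z) pz ∘ sym)) (sym (¬-not (sp≢sq ∘ sym)))
      sz≢sw : s z ≢ s w
      sz≢sw sz≡sw = Equivalence.to (bipartition q w) qw (trans (sym sz≡sq) sz≡sw)

side-↑ˡ : ∀ {r} (i : Fin r) → side r (i ↑ˡ r) ≡ true
side-↑ˡ {r} i = trans (isYes≗does _)
  (dec-true (toℕ (i ↑ˡ r) <? r) (subst (_< r) (sym (toℕ-↑ˡ i r)) (toℕ<n i)))

side-↑ʳ : ∀ {r} (j : Fin r) → side r (r ↑ʳ j) ≡ false
side-↑ʳ {r} j = trans (isYes≗does _)
  (dec-false (toℕ (r ↑ʳ j) <? r) λ lt → <⇒≱ lt (subst (r ≤_) (sym (toℕ-↑ʳ r j)) (m≤m+n r _)))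

side-join : ∀ {r} (x : Fin r ⊎ Fin r) → side r (join r r x) ≡ left? x
side-join (inj₁ i) = side-↑ˡ i
side-join (inj₂ j) = side-↑ʳ j

≅K⇒completeBipartition : ∀ {G r} (iso : G ≅ K r) →
  CompleteBipartition G (side r ∘ Inverse.to (proj₁ iso))
≅K⇒completeBipartition (_ , preserves) a b = mk⇔ (proj₁ (preserves a b)) (proj₂ (preserves a b))

completeBipartition⇒≅K : ∀ {G r s} → CompleteBipartition G s → (φ : Fin (n G) ↔ Fin (r + r)) →
  (∀ w → side r (Inverse.to φ w) ≡ s w) → G ≅ K r
completeBipartition⇒≅K {G} {r} bipartition φ side∘φ≗s = φ , preserves
  where
  preserves : ∀ a b → (Adj G a b → side r (Inverse.to φ a) ≢ side r (Inverse.to φ b))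
                    × (side r (Inverse.to φ a) ≢ side r (Inverse.to φ b) → Adj G a b)
  preserves a b rewrite side∘φ≗s a | side∘φ≗s b =
    Equivalence.to (bipartition a b) , Equivalence.from (bipartition a b)

balanced-completeBipartition⇒≅K : ∀ {G r} {P : Pred (Fin (n G)) 0ℓ} (P? : Decidable P) →
  CompleteBipartition G (does ∘ P?) →
  length (members P?) ≡ r → length (members (∁? P?)) ≡ r → G ≅ K r
balanced-completeBipartition⇒≅K {G} {r} P? bipartition ∣P∣≡r ∣∁P∣≡r
  with ψ , left?∘ψ ← partition-↔ P? ∣P∣≡r ∣∁P∣≡r =
  completeBipartition⇒≅K {G} {s = does ∘ P?} bipartition (↔-trans ψ (↔-sym (+↔⊎ {r} {r})))
    (λ w → trans (side-join (Inverse.to ψ w)) (left?∘ψ w))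

module StrongEdge (G : Graph) {u v : Fin (n G)}
  (strong : ∀ S → MaximalIndependent G S → u ∈ S ⊎ v ∈ S) where

  neighbours-adjacent : ∀ {x y} → Adj G u x → Adj G v y → Adj G x y
  neighbours-adjacent {x} {y} ux vy with adj? G x y
  ... | yes xy = xy
  ... | no ¬xy with R , R-max , xy⊆R ← extend-to-maximal G (pair-independent G ¬xy)
                 with strong R R-max
  ...   | inj₁ u∈R = contradiction ux (proj₁ R-max u x u∈R (xy⊆R ∈-pairˡ))
  ...   | inj₂ v∈R = contradiction vy (proj₁ R-max v y v∈R (xy⊆R ∈-pairʳ))

  N[x]⊆N[v] : ∀ {r} → Regular r G → ∀ {x z} → Adj G u x → Adj G x z → Adj G v z
  N[x]⊆N[v] regular {x} ux =
    regular-neighbourhood-⊆⇒⊇ {G = G} regular {v} {x} (neighbours-adjacent ux)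

module _ {r : ℕ} {G : Graph} (connected : Connected G) (regular : Regular r G)
  {u v : Fin (n G)} (uv : Adj G u v) (strong : ∀ S → MaximalIndependent G S → u ∈ S ⊎ v ∈ S) where

  private
    module U = StrongEdge G strong
    module V = StrongEdge G (λ S S-max → swap (strong S S-max))

    N[u]∩N[v]≡∅ : ∀ {w} → Adj G u w → ¬ Adj G v w
    N[u]∩N[v]≡∅ {w} uw vw = irrefl G w (U.neighbours-adjacent uw vw)

    N[u]∪N[v]≡V : ∀ w → Adj G u w ⊎ Adj G v w
    N[u]∪N[v]≡V = connected⇒everywhere connected step (inj₂ (sym-adj G uv))
      where
      step : ∀ {a b} → Adj G a b → Adj G u a ⊎ Adj G v a → Adj G u b ⊎ Adj G v b
      step ab (inj₁ ua) = inj₂ (U.N[x]⊆N[v] regular ua ab)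
      step ab (inj₂ va) = inj₁ (V.N[x]⊆N[v] regular va ab)

    ∉N[u]⇒∈N[v] : ∀ {w} → ¬ Adj G u w → Adj G v w
    ∉N[u]⇒∈N[v] {w} ¬uw = [ (λ uw → contradiction uw ¬uw) , (λ vw → vw) ]′ (N[u]∪N[v]≡V w)

  strongEdge⇒completeBipartition : CompleteBipartition G (does ∘ adj? G u)
  strongEdge⇒completeBipartition a b with adj? G u a | adj? G u b
  ... | yes ua | yes ub =
    mk⇔ (λ ab → contradiction (U.N[x]⊆N[v] regular ua ab) (N[u]∩N[v]≡∅ ub))
        (λ t≢t → contradiction refl t≢t)
  ... | yes ua | no ¬ub = mk⇔ (λ _ ()) (λ _ → U.neighbours-adjacent ua (∉N[u]⇒∈N[v] ¬ub))
  ... | no ¬ua | yes ub =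
    mk⇔ (λ _ ()) (λ _ → sym-adj G (U.neighbours-adjacent ub (∉N[u]⇒∈N[v] ¬ua)))
  ... | no ¬ua | no ¬ub =
    mk⇔ (λ ab → contradiction (V.N[x]⊆N[v] regular (∉N[u]⇒∈N[v] ¬ua) ab) ¬ub)
        (λ f≢f → contradiction refl f≢f)

  strongEdge⇒≅K : G ≅ K r
  strongEdge⇒≅K =
    balanced-completeBipartition⇒≅K {G} (adj? G u) strongEdge⇒completeBipartition
      (regular u) (trans (cong length ∁N[u]≡N[v]) (regular v))
    where
    ∁N[u]≡N[v] : members (∁? (adj? G u)) ≡ members (adj? G v)
    ∁N[u]≡N[v] = filter-≐ (∁? (adj? G u)) (adj? G v)
      (∉N[u]⇒∈N[v] , λ vw uw → N[u]∩N[v]≡∅ uw vw) (allFin (n G))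

HasStrongClique₂ : Graph → Set
HasStrongClique₂ G = ∃[ C ] (IsStrongClique G C × ∣ C ∣ ≡ 2)

strongClique₂⇒≅K : ∀ {r G} → Connected G → Regular r G → HasStrongClique₂ G → G ≅ K r
strongClique₂⇒≅K {G = G} connected regular (C , (C-clique , C-strong) , ∣C∣≡2)
  with u , v , u≢v , refl ← ∣p∣≡2⇒p≡pair C ∣C∣≡2 =
  strongEdge⇒≅K connected regular (C-clique u v ∈-pairˡ ∈-pairʳ u≢v) endpoint
  where
  endpoint : ∀ S → MaximalIndependent G S → u ∈ S ⊎ v ∈ S
  endpoint S S-max with w , w∈uv , w∈S ← C-strong S S-max with ∈-pair⁻ w∈uv
  ... | inj₁ refl = inj₁ w∈S
  ... | inj₂ refl = inj₂ w∈S

≅K⇒strongClique₂ : ∀ {r G} → G ≅ K (suc r) → HasStrongClique₂ G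
≅K⇒strongClique₂ {r} {G} iso =
  pair p q ,
  completeBipartition-edge-strong {G} {s} (≅K⇒completeBipartition {G} {suc r} iso) sp≢sq ,
  ∣pair∣≡2 p q (sp≢sq ∘ cong s)
  where
  open Inverse (proj₁ iso) using (to; from; strictlyInverseˡ)
  s : Fin (n G) → Bool
  s = side (suc r) ∘ to
  p q : Fin (n G)
  p = from (zero ↑ˡ suc r)
  q = from (suc r ↑ʳ zero)
  sp≢sq : s p ≢ s q
  sp≢sq = subst₂ _≢_ (sym (trans (cong (side (suc r)) (strictlyInverseˡ _)) (side-↑ˡ {suc r} zero)))
                     (sym (trans (cong (side (suc r)) (strictlyInverseˡ _)) (side-↑ʳ {suc r} zero)))
                     (λ ())

lemma6p7 : (r : ℕ) → r ≥ 1 → (G : Graph) → Connected G → Regular r G →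
    ((∃[ C ] (IsStrongClique G C × ∣ C ∣ ≡ 2)) ⇔ (G ≅ K r))
lemma6p7 (suc r) _ G connected regular =
  mk⇔ (strongClique₂⇒≅K {G = G} connected regular) (≅K⇒strongClique₂ {r} {G})
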